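{- If $\phi$ and $\psi$ are two oBDDs over the ordered variables $\{x_1,\dots,x_n\}$, then the encoding proofs satisfy $P(\phi)\sim P(\psi)$ (as MALL$^-$ proofs) if and only if $\phi\sim\psi$ (as BDDs).
   Context: MALL$^-$ proofs (cut-free, atomic axioms, sequents modulo exchange, $\&$ connectives labeled by distinct labels) use: axiom $\vdash\alpha,\alpha^\perp$; $⅋$; $\otimes$: $\Gamma,A$ and $\Delta,B\Rightarrow\Gamma,\Delta,A\otimes B$; $\oplus_l$: $\Gamma,A\Rightarrow\Gamma,A\oplus B$; $\oplus_r$: $\Gamma,B\Rightarrow\Gamma,A\oplus B$; $\&_x$: $\Gamma,A$ and $\Gamma,B\Rightarrow\Gamma,A\&_xB$. Proof equivalence $\sim$: related by the standard permutations of rules; equivalently (Hughes–van Glabbeek) equal slicings, where the slicing $S(\pi)$ is a set of linkings (sets of pairs of dual atom occurrences) defined by: axiom $\{\{[\alpha,\alpha^\perp]\}\}$; $⅋,\oplus$ unchanged; $\otimes$: $\{\lambda\cup\lambda':\lambda\in S(\mu),\lambda'\in S(\nu)\}$; $\&$: $S(\mu)\cup S(\nu)$. BDDs: built from $\mathbf 0,\mathbf 1$ by $\mathtt{If}\,X\,\mathtt{Then}\,\phi\,\mathtt{Else}\,\psi$ and $\mathtt{DontCare}\,X\,\phi$ with the evident evaluation; $\phi\sim\psi$ iff equal evaluation under all valuations. oBDDs over $V=\{x_1,\dots,x_n\}$: $\mathbf 0,\mathbf 1$ are oBDDs over $\emptyset$; if $\psi,\zeta$ are oBDDs over $\{x_1,\dots,x_{n-1}\}$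 then $\mathtt{If}\,x_n\,\mathtt{Then}\,\psi\,\mathtt{Else}\,\zeta$ and $\mathtt{DontCare}\,x_n\,\psi$ are oBDDs over $V$. Encoding: fix atoms $\alpha_1,\dots,\alpha_n,\beta$. Let $\Sigma_0=\Sigma'_0=\beta^\perp$, $\Sigma_n = (\cdots((\beta^\perp\otimes\alpha_1^\perp)\otimes\alpha_2^\perp)\cdots)\otimes\alpha_n^\perp,\ \alpha_1\&_{x_1}\alpha_1,\dots,\alpha_{n-1}\&_{x_{n-1}}\alpha_{n-1}$, and $\Sigma'_n=\Sigma_n,\alpha_n\&_{x_n}\alpha_n$. $\pi_{\mathbf 0}$ (resp. $\pi_{\mathbf 1}$) is the proof of $\beta\oplus\beta,\beta^\perp$ obtained from the axiom $\vdash\beta,\beta^\perp$ by $\oplus_l$ (resp. $\oplus_r$); $\pi^{\&}_n$ is the proof of $\alpha_n^\perp,\alpha_n\&_{x_n}\alpha_n$ by a $\&_{x_n}$ rule on two axioms $\vdash\alpha_n^\perp,\alpha_n$. The proof $P(\phi)$ of $\beta\oplus\beta,\Sigma'_n$ is defined by induction: $P(\mathbf 0)=\pi_{\mathbf 0}$, $P(\mathbf 1)=\pi_{\mathbf 1}$; $P(\mathtt{If}\,x_n\,\mathtt{Then}\,\psi\,\mathtt{Else}\,\zeta)$ is a $\&_{x_n}$ rule whose left premise is a $\otimes$ rule combining $P(\psi)$ with the axiom $\vdash\alpha_n^\perp,\alpha_n$ (concluding $\beta\oplus\beta,\Sigma_n,\alpha_n$) and whose right premise is the same with $P(\zeta)$;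 $P(\mathtt{DontCare}\,x_n\,\psi)$ is a $\otimes$ rule combining $P(\psi)$ with $\pi^\&_n$. -}

module Defs where

open import Data.Nat using (ℕ; zero; suc; _+_)
open import Data.Bool using (Bool; true; false; if_then_else_)
open import Data.Product using (_×_; _,_; Σ-syntax)
open import Data.List using (List; []; _∷_; _++_; [_]; _∷ʳ_; map; length; cartesianProductWith)
open import Data.List.Membership.Propositional using (_∈_)
open import Data.List.Relation.Unary.All using (All)
open import Data.List.Relation.Unary.Any using (Any)
open import Data.List.Relation.Binary.Permutation.Propositional using (_↭_; refl; prep; swap; trans)
open import Relation.Binary.PropositionalEquality using (_≡_)
open import Function.Bundles using (_⇔_)

-- MALL⁻ formulas.  Atoms are indexed by ℕ; `atom a` is α_a, `natom a` is α_a^⊥.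
-- & connectives carry a label (a natural number; x_i is labelled i).

infixr 6 _⊗_ _⅋_ _⊕_

data Formula : Set where
  atom natom : ℕ → Formula
  _⊗_ _⅋_ _⊕_ : Formula → Formula → Formula
  with[_] : ℕ → Formula → Formula → Formula

Sequent : Set
Sequent = List Formula

-- Sequents are lists; the
-- active formula of each logical rule is at the head, and sequents are
-- taken modulo exchange by an explicit exchange rule along any permutation.

data Proof : Sequent → Set where
  ax    : ∀ a → Proof (atom a ∷ natom a ∷ [])
  par   : ∀ {A B Γ} → Proof (A ∷ B ∷ Γ) → Proof (A ⅋ B ∷ Γ)
  tens  : ∀ {A B Γ Δ} → Proof (A ∷ Γ) → Proof (B ∷ Δ) → Proof (A ⊗ B ∷ Γ ++ Δ)
  plusl : ∀ {A Γ} B → Proof (A ∷ Γ) → Proof (A ⊕ B ∷ Γ)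
  plusr : ∀ {B Γ} A → Proof (B ∷ Γ) → Proof (A ⊕ B ∷ Γ)
  wth   : ∀ {A B Γ} x → Proof (A ∷ Γ) → Proof (B ∷ Γ) → Proof (with[ x ] A B ∷ Γ)
  ex    : ∀ {Γ Δ} → Γ ↭ Δ → Proof Γ → Proof Δ

-- Atom occurrences: (position of the formula in the sequent, path inside it).

data Path : Set where
  here : Path
  left right : Path → Path

Occ : Set
Occ = ℕ × Path

-- An axiom link [α, α^⊥]: (occurrence of α, occurrence of α^⊥).
Link : Set
Link = Occ × Occ

Linking : Set
Linking = List Link

Slicing : Set
Slicing = List Linking

relink : (Occ → Occ) → Linking → Linking
relink f = map (λ { (o , o') → f o , f o' })

reslice : (Occ → Occ) → Slicing → Slicing
reslice f = map (relink f)

permIdx : ∀ {Γ Δ : Sequent} → Γ ↭ Δ → ℕ → ℕ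
permIdx refl k = k
permIdx (prep x p) zero = zero
permIdx (prep x p) (suc k) = suc (permIdx p k)
permIdx (swap x y p) zero = 1
permIdx (swap x y p) (suc zero) = 0
permIdx (swap x y p) (suc (suc k)) = suc (suc (permIdx p k))
permIdx (trans p q) k = permIdx q (permIdx p k)

parOcc : Occ → Occ
parOcc (zero , π) = zero , left π
parOcc (suc zero , π) = zero , right π
parOcc (suc (suc k) , π) = suc k , π

headOcc : (Path → Path) → Occ → Occ
headOcc g (zero , π) = zero , g π
headOcc g (suc k , π) = suc k , π

tensROcc : ℕ → Occ → Occ
tensROcc m (zero , π) = zero , right π
tensROcc m (suc k , π) = suc (m + k) , π

exOcc : ∀ {Γ Δ : Sequent} → Γ ↭ Δ → Occ → Occ
exOcc p (k , π) = permIdx p k , π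

-- The slicing S(π) (Hughes–van Glabbeek).
slicing : ∀ {Γ} → Proof Γ → Slicing
slicing (ax a) = [ [ ((0 , here) , (1 , here)) ] ]
slicing (par p) = reslice parOcc (slicing p)
slicing (tens {Γ = Γ} p q) =
  cartesianProductWith (λ l l' → relink (headOcc left) l ++ relink (tensROcc (length Γ)) l')
                       (slicing p) (slicing q)
slicing (plusl B p) = reslice (headOcc left) (slicing p)
slicing (plusr A p) = reslice (headOcc right) (slicing p)
slicing (wth x p q) = reslice (headOcc left) (slicing p) ++ reslice (headOcc right) (slicing q)
slicing (ex σ p) = reslice (exOcc σ) (slicing p)

_≈L_ : Linking → Linking → Set
l ≈L l' = ∀ (e : Link) → (e ∈ l) ⇔ (e ∈ l')

_≈S_ : Slicing → Slicing → Set
S ≈S S' = All (λ l → Any (l ≈L_) S') S × All (λ l' → Any (_≈L l') S) S'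

_∼ₚ_ : ∀ {Γ} → Proof Γ → Proof Γ → Set
p ∼ₚ q = slicing p ≈S slicing q

data BDD : Set where
  𝟎 𝟏 : BDD
  If_Then_Else_ : ℕ → BDD → BDD → BDD
  DontCare : ℕ → BDD → BDD

Valuation : Set
Valuation = ℕ → Bool

eval : BDD → Valuation → Bool
eval 𝟎 v = false
eval 𝟏 v = true
eval (If x Then φ Else ψ) v = if v x then eval φ v else eval ψ v
eval (DontCare x φ) v = eval φ v

_∼B_ : BDD → BDD → Set
φ ∼B ψ = ∀ (v : Valuation) → eval φ v ≡ eval ψ v

data IsOBDD : ℕ → BDD → Set where
  o𝟎 : IsOBDD 0 𝟎
  o𝟏 : IsOBDD 0 𝟏
  oIf : ∀ {n ψ ζ} → IsOBDD n ψ → IsOBDD n ζ → IsOBDD (suc n) (If (suc n) Then ψ Else ζ)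
  oDC : ∀ {n ψ} → IsOBDD n ψ → IsOBDD (suc n) (DontCare (suc n) ψ)

β : Formula
β = atom 0

βᗮ : Formula
βᗮ = natom 0

T : ℕ → Formula
T zero = βᗮ
T (suc n) = T n ⊗ natom (suc n)

-- W n = α_n &_{x_n} α_n, …, α_1 &_{x_1} α_1  (order irrelevant: modulo exchange)
W : ℕ → Sequent
W zero = []
W (suc n) = with[ suc n ] (atom (suc n)) (atom (suc n)) ∷ W n

Σ′ : ℕ → Sequent
Σ′ n = T n ∷ W n

Concl : ℕ → Sequent
Concl n = β ⊕ β ∷ Σ′ n

lastToFront : ∀ (y : Formula) xs → xs ∷ʳ y ↭ y ∷ xs
lastToFront y [] = refl
lastToFront y (x ∷ xs) = trans (prep x (lastToFront y xs)) (swap x y refl)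

rot3 : ∀ (a b c : Formula) L → a ∷ b ∷ c ∷ L ↭ c ∷ b ∷ a ∷ L
rot3 a b c L = trans (swap a b refl) (trans (prep b (swap a c refl)) (swap b c refl))

π𝟎 : Proof (Concl 0)
π𝟎 = plusl β (ax 0)

π𝟏 : Proof (Concl 0)
π𝟏 = plusr β (ax 0)

axᗮ : ∀ a → Proof (natom a ∷ atom a ∷ [])
axᗮ a = ex (swap (atom a) (natom a) refl) (ax a)

π& : ∀ a → Proof (natom a ∷ with[ a ] (atom a) (atom a) ∷ [])
π& a = ex (swap (with[ a ] (atom a) (atom a)) (natom a) refl) (wth a (ax a) (ax a))

ifBranch : ∀ n → Proof (Concl n) →
           Proof (atom (suc n) ∷ T (suc n) ∷ β ⊕ β ∷ W n)
ifBranch n p =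
  ex (lastToFront (atom (suc n)) (T (suc n) ∷ β ⊕ β ∷ W n))
     (tens (ex (swap (β ⊕ β) (T n) refl) p) (axᗮ (suc n)))

P : ∀ {n φ} → IsOBDD n φ → Proof (Concl n)
P o𝟎 = π𝟎
P o𝟏 = π𝟏
P {suc n} (oIf o o') =
  ex (rot3 (with[ suc n ] (atom (suc n)) (atom (suc n))) (T (suc n)) (β ⊕ β) (W n))
     (wth (suc n) (ifBranch n (P o)) (ifBranch n (P o')))
P {suc n} (oDC o) =
  ex (trans (lastToFront (with[ suc n ] (atom (suc n)) (atom (suc n))) (T (suc n) ∷ β ⊕ β ∷ W n))
            (rot3 (with[ suc n ] (atom (suc n)) (atom (suc n))) (T (suc n)) (β ⊕ β) (W n)))
     (tens (ex (swap (β ⊕ β) (T n) refl) (P o)) (π& (suc n)))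

{-# OPTIONS --safe #-}
-- A slice of P(φ) is fixed by choosing one premise of every &_{x_i}, i.e. by a valuation v of
-- x₁,…,xₙ: it links each α_i^⊥ to the left or right α_i of α_i &_{x_i} α_i according to v(x_i),
-- and β^⊥ to the left or right β of β ⊕ β according to φ(v).  Hence the slicing of P(φ) is exactly
-- { linkingOf n v (φ(v)) | v }.  Since linkingOf n v b determines both v on x₁,…,xₙ and b, equal
-- slicings force φ(v) = ψ(v) for every v, and equal evaluations give equal slicings.
module Submission where

open import Defs
open import Data.Nat using (ℕ; zero; suc; _<_; _≟_; z<s; s<s)
open import Data.Nat.Properties using (+-identityʳ; <⇒≢; <⇒≤; n<1+n; m<n⇒m<1+n)
open import Data.Bool using (Bool; true; false; not; if_then_else_)
open import Data.Bool.Properties using (not-injective)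
open import Data.Unit using (⊤; tt)
open import Data.Empty using (⊥-elim)
open import Data.Product using (_×_; _,_; proj₁; proj₂; ∃-syntax; ∃₂)
open import Data.Sum using (inj₁; inj₂)
open import Data.List using ([]; _∷_; _++_; [_]; length)
open import Data.List.Membership.Propositional using (_∈_; find)
open import Data.List.Membership.Propositional.Properties
  using (∈-map⁺; ∈-map⁻; ∈-++⁺ˡ; ∈-++⁺ʳ; ∈-++⁻; ∈-cartesianProductWith⁺; ∈-cartesianProductWith⁻)
open import Data.List.Relation.Binary.Subset.Propositional using (_⊆_)
open import Data.List.Relation.Unary.All as All using (All; []; _∷_)
open import Data.List.Relation.Unary.All.Properties using (++⁺; map⁺)
open import Data.List.Relation.Unary.Any as Any using (here; there)
open import Data.List.Relation.Binary.Permutation.Propositional using (_↭_)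
import Data.List.Relation.Binary.Permutation.Propositional as ↭
open import Relation.Nullary.Decidable using (does; dec-true; dec-false)
open import Relation.Binary.PropositionalEquality
  using (_≡_; _≢_; refl; sym; trans; cong; cong₂; subst; module ≡-Reasoning)
open import Function.Base using (id; _∘_)
open import Function.Bundles using (_⇔_; mk⇔; Equivalence)

permIdx-lastToFront-< : ∀ y xs {k} → k < length xs → permIdx (lastToFront y xs) k ≡ suc k
permIdx-lastToFront-< y (x ∷ xs) {zero} _ = refl
permIdx-lastToFront-< y (x ∷ xs) {suc k} (s<s k<n) rewrite permIdx-lastToFront-< y xs k<n = refl

permIdx-lastToFront-length : ∀ y xs → permIdx (lastToFront y xs) (length xs) ≡ 0
permIdx-lastToFront-length y [] = refl
permIdx-lastToFront-length y (x ∷ xs) rewrite permIdx-lastToFront-length y xs = refl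

≡⇒≈L : ∀ {l l′} → l ≡ l′ → l ≈L l′
≡⇒≈L refl _ = mk⇔ id id

⊆⇒≈S : ∀ {S S′ : Slicing} → S ⊆ S′ → S′ ⊆ S → S ≈S S′
⊆⇒≈S S⊆S′ S′⊆S = All.tabulate (Any.map ≡⇒≈L ∘ S⊆S′) , All.tabulate (Any.map (≡⇒≈L ∘ sym) ∘ S′⊆S)

_[_≔_] : Valuation → ℕ → Bool → Valuation
(v [ x ≔ b ]) y = if does (y ≟ x) then b else v y

≔-same : ∀ v x b → (v [ x ≔ b ]) x ≡ b
≔-same v x b rewrite dec-true (x ≟ x) refl = refl

≔-other : ∀ v {x y} b → y ≢ x → (v [ x ≔ b ]) y ≡ v y
≔-other v {x} {y} b y≢x rewrite dec-false (y ≟ x) y≢x = refl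

Agree : ℕ → Valuation → Valuation → Set
Agree zero v w = ⊤
Agree (suc n) v w = v (suc n) ≡ w (suc n) × Agree n v w

agree-refl : ∀ n {v} → Agree n v v
agree-refl zero = tt
agree-refl (suc n) = refl , agree-refl n

agree-≔ : ∀ n {v x b} → n < x → Agree n v (v [ x ≔ b ])
agree-≔ zero _ = tt
agree-≔ (suc n) {v} n<x = sym (≔-other v _ (<⇒≢ n<x)) , agree-≔ n (<⇒≤ n<x)

eval-agree : ∀ {n φ v w} → IsOBDD n φ → Agree n v w → eval φ v ≡ eval φ w
eval-agree o𝟎 _ = refl
eval-agree o𝟏 _ = refl
eval-agree {w = w} (oIf {n} o o′) (v≡w , v≈w) rewrite v≡w with w (suc n)
... | true = eval-agree o v≈w
... | false = eval-agree o′ v≈w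
eval-agree (oDC o) (_ , v≈w) = eval-agree o v≈w

cofactor : ∀ {n φ} → IsOBDD (suc n) φ → Bool → BDD
cofactor (oIf {ψ = ψ} _ _) true = ψ
cofactor (oIf {ζ = ζ} _ _) false = ζ
cofactor (oDC {ψ = ψ} _) _ = ψ

cofactor-isOBDD : ∀ {n φ} (o : IsOBDD (suc n) φ) b → IsOBDD n (cofactor o b)
cofactor-isOBDD (oIf o _) true = o
cofactor-isOBDD (oIf _ o) false = o
cofactor-isOBDD (oDC o) _ = o

eval-cofactor : ∀ {n φ v b} (o : IsOBDD (suc n) φ) → v (suc n) ≡ b → eval φ v ≡ eval (cofactor o b) v
eval-cofactor {n} {v = v} (oIf _ _) refl with v (suc n)
... | true = refl
... | false = refl
eval-cofactor (oDC _) _ = refl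

side : Bool → Path → Path
side true = left
side false = right

side-injective : ∀ {a b} → side a here ≡ side b here → a ≡ b
side-injective {true} {true} _ = refl
side-injective {false} {false} _ = refl

OccBelow : ℕ → Occ → Set
OccBelow k (i , _) = i < k

LinkBelow : ℕ → Link → Set
LinkBelow k (o , o′) = OccBelow k o × OccBelow k o′

-- Where an occurrence of ⊢ β ⊕ β, Σ′ₙ sits in ⊢ β ⊕ β, Σ′ₙ₊₁: Tₙ becomes the left factor of
-- Tₙ₊₁ and the new α_{n+1} & α_{n+1} is inserted at position 2.
liftOcc : Occ → Occ
liftOcc (zero , π) = zero , π
liftOcc (suc zero , π) = suc zero , left π
liftOcc (suc (suc k) , π) = suc (suc (suc k)) , π

lowerOcc : Occ → Occ
lowerOcc (suc zero , left π) = suc zero , π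
lowerOcc (suc (suc (suc k)) , π) = suc (suc k) , π
lowerOcc o = o

lowerOcc-liftOcc : ∀ o → lowerOcc (liftOcc o) ≡ o
lowerOcc-liftOcc (zero , _) = refl
lowerOcc-liftOcc (suc zero , _) = refl
lowerOcc-liftOcc (suc (suc _) , _) = refl

liftOcc-injective : ∀ {o o′} → liftOcc o ≡ liftOcc o′ → o ≡ o′
liftOcc-injective {o} {o′} eq =
  trans (sym (lowerOcc-liftOcc o)) (trans (cong lowerOcc eq) (lowerOcc-liftOcc o′))

liftOcc≢αᗮ : ∀ o → liftOcc o ≢ (1 , right here)
liftOcc≢αᗮ (zero , _) ()
liftOcc≢αᗮ (suc zero , _) ()
liftOcc≢αᗮ (suc (suc _) , _) ()

liftOcc-below : ∀ {k} o → OccBelow k o → OccBelow (suc k) (liftOcc o)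
liftOcc-below (zero , _) _ = z<s
liftOcc-below (suc zero , _) 1<k = m<n⇒m<1+n 1<k
liftOcc-below (suc (suc _) , _) i<k = s<s i<k

-- (1 , right here) is α_{n+1}^⊥, the right factor of Tₙ₊₁.
newLink : Bool → Link
newLink x = (2 , side x here) , (1 , right here)

extend : Bool → Linking → Linking
extend x l = relink liftOcc l ++ [ newLink x ]

extend-⊆⁻ : ∀ {x y l l′} → extend x l ⊆ extend y l′ → x ≡ y × l ⊆ l′
extend-⊆⁻ {x} {y} {l} {l′} ext⊆ = x≡y , l⊆l′
  where
  x≡y : x ≡ y
  x≡y with ∈-++⁻ (relink liftOcc l′) (ext⊆ (∈-++⁺ʳ (relink liftOcc l) (here refl)))
  ... | inj₂ (here eq) = side-injective (cong (proj₂ ∘ proj₁) eq)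
  ... | inj₁ new∈ with ∈-map⁻ _ new∈
  ...   | (_ , o′) , _ , eq = ⊥-elim (liftOcc≢αᗮ o′ (sym (cong proj₂ eq)))

  l⊆l′ : l ⊆ l′
  l⊆l′ {o , o′} e∈ with ∈-++⁻ (relink liftOcc l′) (ext⊆ (∈-++⁺ˡ (∈-map⁺ _ e∈)))
  ... | inj₂ (here eq) = ⊥-elim (liftOcc≢αᗮ o′ (cong proj₂ eq))
  ... | inj₁ lifted∈ with ∈-map⁻ _ lifted∈
  ...   | (_ , _) , e′∈ , eq with liftOcc-injective (cong proj₁ eq) | liftOcc-injective (cong proj₂ eq)
  ...     | refl | refl = e′∈

-- π𝟎 ends in ⊕_l, so the bit false selects the left β.
linkingOf : ℕ → Valuation → Bool → Linking
linkingOf zero v b = [ (0 , side (not b) here) , (1 , here) ]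
linkingOf (suc n) v b = extend (v (suc n)) (linkingOf n v b)

linkingOf-below : ∀ n {v b} → All (LinkBelow (length (Concl n))) (linkingOf n v b)
linkingOf-below zero = (z<s , s<s z<s) ∷ []
linkingOf-below (suc n) =
  ++⁺ (map⁺ (All.map (λ { {o , o′} (o< , o′<) → liftOcc-below o o< , liftOcc-below o′ o′< }) (linkingOf-below n)))
      ((s<s (s<s z<s) , s<s z<s) ∷ [])

linkingOf-agree : ∀ n {v w} b → Agree n v w → linkingOf n v b ≡ linkingOf n w b
linkingOf-agree zero b _ = refl
linkingOf-agree (suc n) b (v≡w , v≈w) = cong₂ extend v≡w (linkingOf-agree n b v≈w)

linkingOf-⊆-injective : ∀ n {v w b c} → linkingOf n v b ⊆ linkingOf n w c → Agree n v w × b ≡ c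
linkingOf-⊆-injective zero l⊆l′ with l⊆l′ (here refl)
... | here eq = tt , not-injective (side-injective (cong (proj₂ ∘ proj₁) eq))
linkingOf-⊆-injective (suc n) l⊆l′ with extend-⊆⁻ l⊆l′
... | x≡y , l₀⊆l₀′ with linkingOf-⊆-injective n l₀⊆l₀′
... | v≈w , b≡c = (x≡y , v≈w) , b≡c

newWith : ℕ → Formula
newWith n = with[ suc n ] (atom (suc n)) (atom (suc n))

βT-swap : ∀ n → Concl n ↭ T n ∷ β ⊕ β ∷ W n
βT-swap n = ↭.swap (β ⊕ β) (T n) ↭.refl

atomToFront : ∀ n → T (suc n) ∷ β ⊕ β ∷ W n ++ [ atom (suc n) ] ↭ atom (suc n) ∷ T (suc n) ∷ β ⊕ β ∷ W n
atomToFront n = lastToFront (atom (suc n)) (T (suc n) ∷ β ⊕ β ∷ W n)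

withToFront : ∀ n → T (suc n) ∷ β ⊕ β ∷ W n ++ [ newWith n ] ↭ newWith n ∷ T (suc n) ∷ β ⊕ β ∷ W n
withToFront n = lastToFront (newWith n) (T (suc n) ∷ β ⊕ β ∷ W n)

rotate : ∀ n → newWith n ∷ T (suc n) ∷ β ⊕ β ∷ W n ↭ Concl (suc n)
rotate n = rot3 (newWith n) (T (suc n)) (β ⊕ β) (W n)

-- The slices of P (If …) and P (DontCare …) built from a slice l of the proof of the
-- b-cofactor, read off literally from the rules and exchanges used in P.
tensorLinking : ℕ → Linking → Linking → Linking
tensorLinking n l l′ =
  relink (headOcc left) (relink (exOcc (βT-swap n)) l) ++ relink (tensROcc (length (β ⊕ β ∷ W n))) l′

branchLinking : ℕ → Linking → Linking
branchLinking n l = relink (exOcc (atomToFront n)) (tensorLinking n l [ (1 , here) , (0 , here) ])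

ifLinking : ℕ → Bool → Linking → Linking
ifLinking n b l = relink (exOcc (rotate n)) (relink (headOcc (side b)) (branchLinking n l))

dcLinking : ℕ → Bool → Linking → Linking
dcLinking n b l =
  relink (exOcc (↭.trans (withToFront n) (rotate n))) (tensorLinking n l [ (1 , side b here) , (0 , here) ])

nodeLinking : ∀ {n φ} → IsOBDD (suc n) φ → Bool → Linking → Linking
nodeLinking {n} (oIf _ _) = ifLinking n
nodeLinking {n} (oDC _) = dcLinking n

∈-slicing-ifBranch⁻ : ∀ {n l} (p : Proof (Concl n)) →
                      l ∈ slicing (ifBranch n p) → ∃[ l₀ ] l₀ ∈ slicing p × l ≡ branchLinking n l₀
∈-slicing-ifBranch⁻ {n} p l∈ with ∈-map⁻ _ l∈
... | _ , l∈′ , refl with ∈-cartesianProductWith⁻ _ (reslice (exOcc (βT-swap n)) (slicing p)) _ l∈′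
... | _ , _ , l∈″ , here refl , refl with ∈-map⁻ _ l∈″
... | l₀ , l₀∈ , refl = l₀ , l₀∈ , refl

∈-slicing-ifBranch⁺ : ∀ {n l₀} (p : Proof (Concl n)) →
                      l₀ ∈ slicing p → branchLinking n l₀ ∈ slicing (ifBranch n p)
∈-slicing-ifBranch⁺ _ l₀∈ = ∈-map⁺ _ (∈-cartesianProductWith⁺ _ (∈-map⁺ _ l₀∈) (here refl))

∈-slicing-node⁻ : ∀ {n φ l} (o : IsOBDD (suc n) φ) → l ∈ slicing (P o) →
                  ∃₂ λ b l₀ → l₀ ∈ slicing (P (cofactor-isOBDD o b)) × l ≡ nodeLinking o b l₀
∈-slicing-node⁻ {n} (oIf o o′) l∈ with ∈-map⁻ _ l∈
... | _ , l∈′ , refl with ∈-++⁻ (reslice (headOcc left) (slicing (ifBranch n (P o)))) l∈′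
... | inj₁ l∈″ with ∈-map⁻ _ l∈″
... | _ , l∈‴ , refl with ∈-slicing-ifBranch⁻ (P o) l∈‴
... | l₀ , l₀∈ , refl = true , l₀ , l₀∈ , refl
∈-slicing-node⁻ {n} (oIf o o′) l∈ | _ , l∈′ , refl | inj₂ l∈″ with ∈-map⁻ _ l∈″
... | _ , l∈‴ , refl with ∈-slicing-ifBranch⁻ (P o′) l∈‴
... | l₀ , l₀∈ , refl = false , l₀ , l₀∈ , refl
∈-slicing-node⁻ {n} (oDC o) l∈ with ∈-map⁻ _ l∈
... | _ , l∈′ , refl with ∈-cartesianProductWith⁻ _ (reslice (exOcc (βT-swap n)) (slicing (P o))) _ l∈′
... | _ , _ , l∈″ , ax∈ , refl with ∈-map⁻ _ l∈″ | ax∈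
... | l₀ , l₀∈ , refl | here refl = true , l₀ , l₀∈ , refl
... | l₀ , l₀∈ , refl | there (here refl) = false , l₀ , l₀∈ , refl

∈-slicing-node⁺ : ∀ {n φ l₀} (o : IsOBDD (suc n) φ) b →
                  l₀ ∈ slicing (P (cofactor-isOBDD o b)) → nodeLinking o b l₀ ∈ slicing (P o)
∈-slicing-node⁺ {n} (oIf o _) true l₀∈ =
  ∈-map⁺ (relink (exOcc (rotate n)))
    (∈-++⁺ˡ (∈-map⁺ (relink (headOcc left)) (∈-slicing-ifBranch⁺ (P o) l₀∈)))
∈-slicing-node⁺ {n} (oIf o o′) false l₀∈ =
  ∈-map⁺ (relink (exOcc (rotate n)))
    (∈-++⁺ʳ (reslice (headOcc left) (slicing (ifBranch n (P o))))
      (∈-map⁺ (relink (headOcc right)) (∈-slicing-ifBranch⁺ (P o′) l₀∈)))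
∈-slicing-node⁺ (oDC _) true l₀∈ = ∈-map⁺ _ (∈-cartesianProductWith⁺ _ (∈-map⁺ _ l₀∈) (here refl))
∈-slicing-node⁺ (oDC _) false l₀∈ = ∈-map⁺ _ (∈-cartesianProductWith⁺ _ (∈-map⁺ _ l₀∈) (there (here refl)))

lastToFront-after-tensR : ∀ n y →
  permIdx (lastToFront y (T (suc n) ∷ β ⊕ β ∷ W n)) (proj₁ (tensROcc (length (β ⊕ β ∷ W n)) (1 , here))) ≡ 0
lastToFront-after-tensR n y
  rewrite +-identityʳ (length (W n)) = permIdx-lastToFront-length y (T (suc n) ∷ β ⊕ β ∷ W n)

-- The exchanges of P agree with liftOcc only on the positions of ⊢ β ⊕ β, Σ′ₙ, hence the bound.
ifOcc-lift : ∀ n b {o} → OccBelow (length (Concl n)) o →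
  exOcc (rotate n) (headOcc (side b) (exOcc (atomToFront n) (headOcc left (exOcc (βT-swap n) o)))) ≡ liftOcc o
ifOcc-lift n b {zero , _} _ = refl
ifOcc-lift n b {suc zero , _} _ = refl
ifOcc-lift n b {suc (suc _) , _} (s<s (s<s k<))
  rewrite permIdx-lastToFront-< (atom (suc n)) (W n) k< = refl

dcOcc-lift : ∀ n {o} → OccBelow (length (Concl n)) o →
  exOcc (↭.trans (withToFront n) (rotate n)) (headOcc left (exOcc (βT-swap n) o)) ≡ liftOcc o
dcOcc-lift n {zero , _} _ = refl
dcOcc-lift n {suc zero , _} _ = refl
dcOcc-lift n {suc (suc _) , _} (s<s (s<s k<))
  rewrite permIdx-lastToFront-< (newWith n) (W n) k< = refl

ifLinking-extend : ∀ n b {l} → All (LinkBelow (length (Concl n))) l → ifLinking n b l ≡ extend b l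
ifLinking-extend n b [] =
  cong (λ i → [ exOcc (rotate n) (headOcc (side b) (i , here)) , (1 , right here) ])
       (lastToFront-after-tensR n (atom (suc n)))
ifLinking-extend n b ((o< , o′<) ∷ below) =
  cong₂ _∷_ (cong₂ _,_ (ifOcc-lift n b o<) (ifOcc-lift n b o′<)) (ifLinking-extend n b below)

dcLinking-extend : ∀ n b {l} → All (LinkBelow (length (Concl n))) l → dcLinking n b l ≡ extend b l
dcLinking-extend n b [] =
  cong (λ i → [ exOcc (rotate n) (i , side b here) , (1 , right here) ])
       (lastToFront-after-tensR n (newWith n))
dcLinking-extend n b ((o< , o′<) ∷ below) =
  cong₂ _∷_ (cong₂ _,_ (dcOcc-lift n o<) (dcOcc-lift n o′<)) (dcLinking-extend n b below)

nodeLinking-extend : ∀ {n φ l} (o : IsOBDD (suc n) φ) b →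
                     All (LinkBelow (length (Concl n))) l → nodeLinking o b l ≡ extend b l
nodeLinking-extend {n} (oIf _ _) b = ifLinking-extend n b
nodeLinking-extend {n} (oDC _) b = dcLinking-extend n b

nodeLinking-linkingOf : ∀ {n φ b v w} (o : IsOBDD (suc n) φ) → Agree n v w → w (suc n) ≡ b →
  nodeLinking o b (linkingOf n v (eval (cofactor o b) v)) ≡ linkingOf (suc n) w (eval φ w)
nodeLinking-linkingOf {n} {φ} {b} {v} {w} o v≈w w≡b = begin
  nodeLinking o b (linkingOf n v (eval χ v))
    ≡⟨ nodeLinking-extend o b (linkingOf-below n) ⟩
  extend b (linkingOf n v (eval χ v))
    ≡⟨ cong (extend b ∘ linkingOf n v) (eval-agree (cofactor-isOBDD o b) v≈w) ⟩
  extend b (linkingOf n v (eval χ w))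
    ≡⟨ cong (extend b) (linkingOf-agree n _ v≈w) ⟩
  extend b (linkingOf n w (eval χ w))
    ≡⟨ cong₂ (λ x c → extend x (linkingOf n w c)) (sym w≡b) (sym (eval-cofactor o w≡b)) ⟩
  linkingOf (suc n) w (eval φ w)
    ∎
  where
  open ≡-Reasoning
  χ : BDD
  χ = cofactor o b

-- cofactor-isOBDD o b is not a syntactic subterm of o, so the caller supplies the induction hypotheses.
∈-slicing-P⁻-node : ∀ {n φ} (o : IsOBDD (suc n) φ) →
  (∀ b {l} → l ∈ slicing (P (cofactor-isOBDD o b)) → ∃[ v ] l ≡ linkingOf n v (eval (cofactor o b) v)) →
  ∀ {l} → l ∈ slicing (P o) → ∃[ v ] l ≡ linkingOf (suc n) v (eval φ v)
∈-slicing-P⁻-node {n} o ih l∈ with ∈-slicing-node⁻ o l∈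
... | b , _ , l₀∈ , refl with ih b l₀∈
... | v , refl = v [ suc n ≔ b ] , nodeLinking-linkingOf o (agree-≔ n (n<1+n n)) (≔-same v (suc n) b)

∈-slicing-P⁺-node : ∀ {n φ} (o : IsOBDD (suc n) φ) →
  (∀ b v → linkingOf n v (eval (cofactor o b) v) ∈ slicing (P (cofactor-isOBDD o b))) →
  ∀ v → linkingOf (suc n) v (eval φ v) ∈ slicing (P o)
∈-slicing-P⁺-node {n} o ih v =
  subst (_∈ slicing (P o)) (nodeLinking-linkingOf o (agree-refl n) refl)
        (∈-slicing-node⁺ o (v (suc n)) (ih (v (suc n)) v))

∈-slicing-P⁻ : ∀ {n φ l} (o : IsOBDD n φ) → l ∈ slicing (P o) → ∃[ v ] l ≡ linkingOf n v (eval φ v)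
∈-slicing-P⁻ o𝟎 (here refl) = (λ _ → false) , refl
∈-slicing-P⁻ o𝟏 (here refl) = (λ _ → false) , refl
∈-slicing-P⁻ (oIf o o′) = ∈-slicing-P⁻-node (oIf o o′) λ { true → ∈-slicing-P⁻ o ; false → ∈-slicing-P⁻ o′ }
∈-slicing-P⁻ (oDC o) = ∈-slicing-P⁻-node (oDC o) λ _ → ∈-slicing-P⁻ o

∈-slicing-P⁺ : ∀ {n φ} (o : IsOBDD n φ) v → linkingOf n v (eval φ v) ∈ slicing (P o)
∈-slicing-P⁺ o𝟎 _ = here refl
∈-slicing-P⁺ o𝟏 _ = here refl
∈-slicing-P⁺ (oIf o o′) = ∈-slicing-P⁺-node (oIf o o′) λ { true → ∈-slicing-P⁺ o ; false → ∈-slicing-P⁺ o′ }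
∈-slicing-P⁺ (oDC o) = ∈-slicing-P⁺-node (oDC o) λ _ → ∈-slicing-P⁺ o

∼B⇒slicing-⊆ : ∀ {n φ ψ} (o : IsOBDD n φ) (o′ : IsOBDD n ψ) → φ ∼B ψ → slicing (P o) ⊆ slicing (P o′)
∼B⇒slicing-⊆ {n} o o′ φ∼ψ l∈ with ∈-slicing-P⁻ o l∈
... | v , refl = subst (λ b → linkingOf n v b ∈ slicing (P o′)) (sym (φ∼ψ v)) (∈-slicing-P⁺ o′ v)

∼ₚ⇒∼B : ∀ {n φ ψ} (o : IsOBDD n φ) (o′ : IsOBDD n ψ) → P o ∼ₚ P o′ → φ ∼B ψ
∼ₚ⇒∼B {n} o o′ (S≲S′ , _) v with find (All.lookup S≲S′ (∈-slicing-P⁺ o v))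
... | _ , l′∈ , l≈l′ with ∈-slicing-P⁻ o′ l′∈
... | w , refl with linkingOf-⊆-injective n (λ {e} → Equivalence.to (l≈l′ e))
... | v≈w , φv≡ψw = trans φv≡ψw (sym (eval-agree o′ v≈w))

mainTheorem6 : ∀ (n : ℕ) {φ ψ : BDD} (o : IsOBDD n φ) (o′ : IsOBDD n ψ) →
                 (P o ∼ₚ P o′) ⇔ (φ ∼B ψ)
mainTheorem6 n o o′ = mk⇔ (∼ₚ⇒∼B o o′) λ φ∼ψ →
  ⊆⇒≈S (∼B⇒slicing-⊆ o o′ φ∼ψ) (∼B⇒slicing-⊆ o′ o (sym ∘ φ∼ψ))
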